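{- Let $\mathcal{S} = \{S_1, \ldots, S_k\}$ be a set system with $|S_k| \geq 1$ and $|S_i| \geq 2$ for all $i \in \{1,\dots,k-1\}$, and let $P$ be a finite pot with $\bigcup\mathcal{S}\subseteq P$ and $|P|\geq k$. Then Fixer has a winning strategy against Breaker $\mathfrak{B}_1$ in the game described below.
   Context: A set system is a finite family of finite sets; members are treated as indexed positions. A transversal of $\mathcal{S}$ is an injection $f:\mathcal{S}\to\bigcup\mathcal{S}$ with $f(S)\in S$ for each $S$. The game is played by Fixer and Breaker on the current set system with fixed pot $P\supseteq\bigcup\mathcal{S}$; players alternate, Fixer first. Fixer's move: pick $x \in P$ and a member $S$ with $x \notin S$, and replace $S$ by $(S \cup \{x\}) \setminus \{y\}$ for some $y \in S$. Breaker $\mathfrak{B}_t$'s reply (here $t=1$): if Fixer modified $S$ by inserting $x$ and removing $y$, Breaker may pick at most $t$ members other than $S$ and modify each by swapping $x$ for $y$ or $y$ for $x$. Fixer wins iff he can (after finitely many rounds) bring the set system to a state that has a transversal. -}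

module Defs where

open import Data.Nat using (ℕ; zero; suc; _≤_)
open import Data.Fin using (Fin; fromℕ; inject₁)
open import Data.Fin.Subset using (Subset; _∈_; _∉_; ∣_∣; inside; outside)
open import Data.Vec using (Vec; lookup; _[_]≔_)
open import Data.Product using (Σ; _×_)
open import Function.Definitions using (Injective)
open import Relation.Binary.PropositionalEquality using (_≡_; _≢_)

-- The pot P is (WLOG) the finite set Fin n; members of the set system
-- are subsets of Fin n, indexed by positions Fin k.
SetSystem : ℕ → ℕ → Set
SetSystem n k = Vec (Subset n) k

exchange : ∀ {n} → Subset n → (a b : Fin n) → Subset n
exchange S a b = (S [ a ]≔ inside) [ b ]≔ outside

Transversal : ∀ {n k} → SetSystem n k → Set
Transversal {n} {k} 𝒮 =
  Σ (Fin k → Fin n) λ f → Injective _≡_ _≡_ f × (∀ i → f i ∈ lookup 𝒮 i)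

fixerMove : ∀ {n k} → SetSystem n k → (i : Fin k) (x y : Fin n) → SetSystem n k
fixerMove 𝒮 i x y = 𝒮 [ i ]≔ exchange (lookup 𝒮 i) x y

data Breaker₁Reply {n k} (i : Fin k) (x y : Fin n) (𝒮 : SetSystem n k)
     : SetSystem n k → Set where
  pass   : Breaker₁Reply i x y 𝒮 𝒮
  swapxy : (j : Fin k) → j ≢ i → x ∈ lookup 𝒮 j → y ∉ lookup 𝒮 j →
           Breaker₁Reply i x y 𝒮 (𝒮 [ j ]≔ exchange (lookup 𝒮 j) y x)
  swapyx : (j : Fin k) → j ≢ i → y ∈ lookup 𝒮 j → x ∉ lookup 𝒮 j →
           Breaker₁Reply i x y 𝒮 (𝒮 [ j ]≔ exchange (lookup 𝒮 j) x y)

-- Fixer (moving first) has a winning strategy against 𝔅₁ from 𝒮,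
-- pot Fin n: inductively, either 𝒮 already has a transversal, or Fixer
-- has a legal move such that after every legal reply of Breaker, Fixer
-- again has a winning strategy. (Inductive, so finitely many rounds.)
data FixerWins₁ {n k} : SetSystem n k → Set where
  done : ∀ {𝒮} → Transversal 𝒮 → FixerWins₁ 𝒮
  move : ∀ {𝒮} (i : Fin k) (x y : Fin n) →
         x ∉ lookup 𝒮 i → y ∈ lookup 𝒮 i →
         (∀ 𝒮′ → Breaker₁Reply i x y (fixerMove 𝒮 i x y) 𝒮′ → FixerWins₁ 𝒮′) →
         FixerWins₁ 𝒮

module Submission where

-- Fixer gradually locks members, each to a private representative.  A
-- position is Good when the locked ("closed") members have distinct
-- representatives that are no longer free, there are at least as many free
-- elements as open members, and every open member has at least two free
-- elements, except possibly one special member which has at least one.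
-- In a Good position with an open member, double counting the incidences
-- between free elements and tight open members (those with at most two free
-- elements) produces a free element e lying in few tight members.  If no open
-- member contains e, Fixer moves e into a suitable open member; Breaker's one
-- swap merely reshuffles free elements and disturbs one other member, which
-- becomes the new special member once the moved member is locked with e.
-- Otherwise an open member containing e is locked with e without moving.
-- Either way a Good position with one open member fewer arises, and when no
-- member is open the representatives form a transversal.

open import Defs
open import Data.Nat using (ℕ; zero; suc; _+_; _*_; _≤_; _<_; z≤n; s≤s; _≤ᵇ_)
open import Data.Nat.Properties
  using ( +-*-semiring; +-identityʳ; +-comm; +-assoc; *-identityʳ; *-zeroʳ
        ; +-mono-≤; +-monoʳ-≤; +-monoˡ-≤; +-mono-<-≤; *-monoʳ-≤; +-cancelʳ-≤; +-cancelʳ-≡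
        ; ≤-reflexive; ≤-trans; ≤-pred; n≤1+n; m≤m+n; <⇒≱; ≮⇒≥; ≰⇒>
        ; _≤?_; _<?_; ≤ᵇ⇒≤; ≤⇒≤ᵇ; module ≤-Reasoning )
open import Data.Fin using (Fin; zero; suc; toℕ; fromℕ; inject₁; inject≤; lower₁; punchIn; _≟_)
open import Data.Fin.Properties using (any?; punchInᵢ≢i; toℕ-injective; toℕ-fromℕ; inject₁-lower₁)
open import Data.Fin.Subset using (Subset; _∈_; _∉_; ∣_∣; inside; outside)
open import Data.Vec using ([]; _∷_; lookup; _[_]≔_)
open import Data.Vec.Properties using (lookup∘update; lookup∘update′; []=⇒lookup; lookup⇒[]=)
open import Data.Vec.Functional using (removeAt; updateAt)
open import Data.Vec.Functional.Properties using (updateAt-updates; updateAt-minimal)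
open import Data.Bool using (Bool; true; false; _∧_; T)
open import Data.Bool.Properties using (∧-comm; ∧-assoc; ∧-identityʳ; ∧-zeroʳ; ¬-not) renaming (_≟_ to _≟ᵇ_)
open import Data.Product using (∃; _×_; _,_; proj₁; proj₂)
open import Data.Sum using (_⊎_; inj₁; inj₂)
open import Data.Empty using (⊥-elim)
open import Function using (const)
open import Relation.Nullary using (yes; no)
open import Relation.Nullary.Decidable using (_×-dec_)
open import Relation.Binary.PropositionalEquality
  using (_≡_; _≢_; refl; sym; trans; cong; cong₂; subst; subst₂; ≢-sym; module ≡-Reasoning)
open import Algebra.Properties.Semiring.Sum +-*-semiring
  using (sum; sum-syntax; sum-cong-≗; sum-remove; ∑-comm; *-distribˡ-sum; sum-replicate-zero)

distinct-by : ∀ {a} {A : Set a} (P : A → Bool) {x y : A} →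
  P x ≡ true → P y ≡ false → y ≢ x
distinct-by P Px Py refl with trans (sym Px) Py
... | ()

∧-true : ∀ {a b} → a ∧ b ≡ true → a ≡ true × b ≡ true
∧-true {true} b≡true = refl , b≡true

∧-false-if : ∀ {a b} → b ≡ true → a ∧ b ≡ false → a ≡ false
∧-false-if {true} b≡true a∧b≡false = trans (sym b≡true) a∧b≡false
∧-false-if {false} _ _ = refl

ind : Bool → ℕ
ind true  = 1
ind false = 0

ind≤1 : ∀ b → ind b ≤ 1
ind≤1 true  = s≤s z≤n
ind≤1 false = z≤n

ind-∧ : ∀ a b → ind a * ind b ≡ ind (a ∧ b)
ind-∧ true  b = +-identityʳ (ind b)
ind-∧ false b = refl

ind-*-≤ : ∀ b c → ind b * c ≤ c
ind-*-≤ true  c = ≤-reflexive (+-identityʳ c)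
ind-*-≤ false c = z≤n

count : ∀ {n} → (Fin n → Bool) → ℕ
count {n} P = ∑[ z < n ] ind (P z)

sum-mono : ∀ {n} {f g : Fin n → ℕ} → (∀ z → f z ≤ g z) → sum f ≤ sum g
sum-mono {zero}  f≤g = z≤n
sum-mono {suc n} f≤g = +-mono-≤ (f≤g zero) (sum-mono (λ z → f≤g (suc z)))

sum-strict : ∀ {n} {f g : Fin n → ℕ} (a : Fin n) →
  (∀ z → f z ≤ g z) → f a < g a → sum f < sum g
sum-strict {suc n} {f} {g} a f≤g fa<ga = begin-strict
  sum f                     ≡⟨ sum-remove {i = a} f ⟩
  f a + sum (removeAt f a)  <⟨ +-mono-<-≤ fa<ga (sum-mono (λ z → f≤g (punchIn a z))) ⟩
  g a + sum (removeAt g a)  ≡⟨ sym (sum-remove {i = a} g) ⟩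
  sum g                     ∎
  where open ≤-Reasoning

term≤sum : ∀ {n} (f : Fin n → ℕ) (a : Fin n) → f a ≤ sum f
term≤sum {suc n} f a = ≤-trans (m≤m+n (f a) _) (≤-reflexive (sym (sum-remove {i = a} f)))

sum-agree-off : ∀ {n} {f g : Fin n → ℕ} (a : Fin n) →
  (∀ z → z ≢ a → f z ≡ g z) → sum f + g a ≡ sum g + f a
sum-agree-off {suc n} {f} {g} a agree = begin
  sum f + g a                     ≡⟨ cong (_+ g a) (sum-remove {i = a} f) ⟩
  f a + sum (removeAt f a) + g a  ≡⟨ cong (λ s → f a + s + g a) (sum-cong-≗ same-rest) ⟩
  f a + sum (removeAt g a) + g a  ≡⟨ swap-ends (f a) _ (g a) ⟩
  g a + sum (removeAt g a) + f a  ≡⟨ cong (_+ f a) (sym (sum-remove {i = a} g)) ⟩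
  sum g + f a                     ∎
  where
  open ≡-Reasoning
  same-rest : ∀ z → removeAt f a z ≡ removeAt g a z
  same-rest z = agree (punchIn a z) (punchInᵢ≢i a z)
  swap-ends : ∀ x s y → x + s + y ≡ y + s + x
  swap-ends x s y = trans (+-comm (x + s) y) (trans (cong (y +_) (+-comm x s)) (sym (+-assoc y s x)))

count-none : ∀ {n} (P : Fin n → Bool) → (∀ z → P z ≡ false) → count P ≡ 0
count-none {n} P none = trans (sum-cong-≗ (λ z → cong ind (none z))) (sum-replicate-zero n)

count-pos : ∀ {n} (P : Fin n → Bool) {a} → P a ≡ true → 1 ≤ count P
count-pos P {a} Pa = subst (_≤ count P) (cong ind Pa) (term≤sum (λ z → ind (P z)) a)

count-zero : ∀ {n} (P : Fin n → Bool) → count P ≤ 0 → ∀ z → P z ≡ false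
count-zero P count≤0 z with P z in Pz
... | false = refl
... | true  = ⊥-elim (<⇒≱ (count-pos P Pz) count≤0)

count-witness : ∀ {n} (P : Fin n → Bool) → 1 ≤ count P → ∃ λ z → P z ≡ true
count-witness P count≥1 with any? (λ z → P z ≟ᵇ true)
... | yes found = found
... | no none   = ⊥-elim (<⇒≱ count≥1 (≤-reflexive (count-none P (λ z → ¬-not (λ Pz → none (z , Pz))))))

_⊖_ : ∀ {n} → (Fin n → Bool) → Fin n → (Fin n → Bool)
P ⊖ a = updateAt P a (const false)

⊖-self : ∀ {n} (P : Fin n → Bool) a → (P ⊖ a) a ≡ false
⊖-self P a = updateAt-updates a P

⊖-other : ∀ {n} (P : Fin n → Bool) {a z} → z ≢ a → (P ⊖ a) z ≡ P z
⊖-other P {a} {z} z≢a = updateAt-minimal z a P z≢a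

⊖-true : ∀ {n} (P : Fin n → Bool) {a z} → (P ⊖ a) z ≡ true → z ≢ a × P z ≡ true
⊖-true P {a} {z} removed with z ≟ a
... | yes refl = ⊥-elim (distinct-by (P ⊖ a) removed (⊖-self P a) refl)
... | no z≢a   = z≢a , trans (sym (⊖-other P z≢a)) removed

⊖-false : ∀ {n} (P : Fin n → Bool) {a z} → P z ≡ false → (P ⊖ a) z ≡ false
⊖-false P {a} {z} Pz with z ≟ a
... | yes refl = ⊖-self P a
... | no z≢a   = trans (⊖-other P z≢a) Pz

count-⊖ : ∀ {n} (P : Fin n → Bool) a → count (P ⊖ a) + ind (P a) ≡ count P
count-⊖ P a = begin
  count (P ⊖ a) + ind (P a)  ≡⟨ sum-agree-off a (λ z z≢a → cong ind (⊖-other P z≢a)) ⟩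
  count P + ind ((P ⊖ a) a)  ≡⟨ cong (λ b → count P + ind b) (⊖-self P a) ⟩
  count P + 0                ≡⟨ +-identityʳ (count P) ⟩
  count P                    ∎
  where open ≡-Reasoning

count-⊖-true : ∀ {n} (P : Fin n → Bool) {a} → P a ≡ true → count (P ⊖ a) + 1 ≡ count P
count-⊖-true P {a} Pa = trans (cong (λ b → count (P ⊖ a) + ind b) (sym Pa)) (count-⊖ P a)

count-⊖-≤ : ∀ {n} (P : Fin n → Bool) {a t} → P a ≡ true → count P ≤ suc t → count (P ⊖ a) ≤ t
count-⊖-≤ P {a} {t} Pa count≤ = +-cancelʳ-≤ 1 _ _ (begin
  count (P ⊖ a) + 1  ≡⟨ count-⊖-true P Pa ⟩
  count P            ≤⟨ count≤ ⟩
  suc t              ≡⟨ +-comm 1 t ⟩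
  t + 1              ∎)
  where open ≤-Reasoning

pick : ∀ {k} (U : Fin k → Bool) (d : Fin k) →
  ∃ λ i → (U i ≡ true ⊎ i ≡ d) × (∀ {t} → count U ≤ suc t → count (U ⊖ i) ≤ t)
pick U d with any? (λ z → U z ≟ᵇ true)
... | yes (i , Ui) = i , inj₁ Ui , count-⊖-≤ U Ui
... | no none      = d , inj₂ refl , λ _ → ≤-trans (≤-reflexive (count-none (U ⊖ d) (λ z → ⊖-false U (empty z)))) z≤n
  where
  empty : ∀ z → U z ≡ false
  empty z = ¬-not (λ Uz → none (z , Uz))

double-count : ∀ {k n} (A : Fin k → Bool) (B : Fin n → Bool) (M : Fin k → Fin n → Bool) →
  ∑[ z < n ] (ind (B z) * count (λ l → A l ∧ M l z)) ≡
  ∑[ l < k ] (ind (A l) * count (λ z → M l z ∧ B z))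
double-count {k} {n} A B M = begin
  ∑[ z < n ] (ind (B z) * count (λ l → A l ∧ M l z))
    ≡⟨ sum-cong-≗ (λ z → *-distribˡ-sum (ind (B z)) (λ l → ind (A l ∧ M l z))) ⟩
  ∑[ z < n ] ∑[ l < k ] (ind (B z) * ind (A l ∧ M l z))
    ≡⟨ sum-cong-≗ (λ z → sum-cong-≗ (λ l → reorder (B z) (A l) (M l z))) ⟩
  ∑[ z < n ] ∑[ l < k ] (ind (A l) * ind (M l z ∧ B z))
    ≡⟨ ∑-comm (λ z l → ind (A l) * ind (M l z ∧ B z)) ⟩
  ∑[ l < k ] ∑[ z < n ] (ind (A l) * ind (M l z ∧ B z))
    ≡⟨ sum-cong-≗ (λ l → sym (*-distribˡ-sum (ind (A l)) (λ z → ind (M l z ∧ B z)))) ⟩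
  ∑[ l < k ] (ind (A l) * count (λ z → M l z ∧ B z)) ∎
  where
  open ≡-Reasoning
  reorder : ∀ b a m → ind b * ind (a ∧ m) ≡ ind a * ind (m ∧ b)
  reorder b a m = trans (ind-∧ b (a ∧ m))
    (trans (cong ind (trans (∧-comm b (a ∧ m)) (∧-assoc a m b))) (sym (ind-∧ a (m ∧ b))))

pigeonhole : ∀ {n} (B : Fin n → Bool) (f : Fin n → ℕ) (K : ℕ) →
  ∑[ z < n ] (ind (B z) * f z) < K * count B → ∃ λ z → B z ≡ true × f z < K
pigeonhole B f K small with any? (λ z → (B z ≟ᵇ true) ×-dec (f z <? K))
... | yes found = found
... | no none   = ⊥-elim (<⇒≱ small (begin
  K * count B               ≡⟨ *-distribˡ-sum K (λ z → ind (B z)) ⟩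
  ∑[ z < _ ] (K * ind (B z))  ≤⟨ sum-mono termwise ⟩
  ∑[ z < _ ] (ind (B z) * f z) ∎))
  where
  open ≤-Reasoning
  termwise : ∀ z → K * ind (B z) ≤ ind (B z) * f z
  termwise z with B z in Bz
  ... | true  = ≤-trans (≤-reflexive (*-identityʳ K))
                  (≤-trans (≮⇒≥ (λ fz<K → none (z , Bz , fz<K))) (≤-reflexive (sym (+-identityʳ (f z)))))
  ... | false = ≤-reflexive (*-zeroʳ K)

sum-≤-scaled : ∀ {n} {g : Fin n → ℕ} (K : ℕ) (C : Fin n → Bool) →
  (∀ z → g z ≤ K * ind (C z)) → sum g ≤ K * count C
sum-≤-scaled K C g≤ = ≤-trans (sum-mono g≤) (≤-reflexive (sym (*-distribˡ-sum K (λ z → ind (C z)))))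

sum-<-scaled : ∀ {n} {g : Fin n → ℕ} (K : ℕ) (C : Fin n → Bool) →
  (∀ z → g z ≤ K * ind (C z)) → ∀ a → g a < K * ind (C a) → sum g < K * count C
sum-<-scaled K C g≤ a ga< = ≤-trans (sum-strict a g≤ ga<) (≤-reflexive (sym (*-distribˡ-sum K (λ z → ind (C z)))))

mem : ∀ {n k} → SetSystem n k → Fin k → Fin n → Bool
mem 𝒮 l z = lookup (lookup 𝒮 l) z

freeIn : ∀ {n} → Subset n → (Fin n → Bool) → ℕ
freeIn S E = count (λ z → lookup S z ∧ E z)

free : ∀ {n k} → SetSystem n k → (Fin n → Bool) → Fin k → ℕ
free 𝒮 E l = freeIn (lookup 𝒮 l) E

true⇒∈ : ∀ {n} {S : Subset n} {x} → lookup S x ≡ true → x ∈ S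
true⇒∈ {S = S} {x} = lookup⇒[]= x S

false⇒∉ : ∀ {n} {S : Subset n} {x} → lookup S x ≡ false → x ∉ S
false⇒∉ {S = S} Sx x∈S = distinct-by (lookup S) ([]=⇒lookup x∈S) Sx refl

∉⇒false : ∀ {n} {S : Subset n} {x} → x ∉ S → lookup S x ≡ false
∉⇒false x∉S = ¬-not (λ Sx → x∉S (true⇒∈ Sx))

exchange-in : ∀ {n} (S : Subset n) {a b} → a ≢ b → lookup (exchange S a b) a ≡ true
exchange-in S {a} a≢b = trans (lookup∘update′ a≢b (S [ a ]≔ inside) outside) (lookup∘update a S inside)

exchange-rest : ∀ {n} (S : Subset n) {a b z} → z ≢ a → z ≢ b → lookup (exchange S a b) z ≡ lookup S z
exchange-rest S {a} z≢a z≢b = trans (lookup∘update′ z≢b (S [ a ]≔ inside) outside) (lookup∘update′ z≢a S inside)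

freeIn-update : ∀ {n} (S : Subset n) (E : Fin n → Bool) a v →
  freeIn (S [ a ]≔ v) E + ind (lookup S a ∧ E a) ≡ freeIn S E + ind (v ∧ E a)
freeIn-update S E a v =
  trans (sum-agree-off a (λ z z≢a → cong (λ b → ind (b ∧ E z)) (lookup∘update′ z≢a S v)))
        (cong (λ b → freeIn S E + ind (b ∧ E a)) (lookup∘update a S v))

freeIn-exchange : ∀ {n} (S : Subset n) (E : Fin n → Bool) {a b} →
  E a ≡ true → E b ≡ true → lookup S a ≡ false → lookup S b ≡ true →
  freeIn (exchange S a b) E ≡ freeIn S E
freeIn-exchange S E {a} {b} Ea Eb Sa Sb = +-cancelʳ-≡ 1 _ _ (begin
  freeIn S₂ E + 1                       ≡⟨ cong (λ c → freeIn S₂ E + ind c) (sym (cong₂ _∧_ S₁b Eb)) ⟩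
  freeIn S₂ E + ind (lookup S₁ b ∧ E b) ≡⟨ freeIn-update S₁ E b outside ⟩
  freeIn S₁ E + 0                       ≡⟨ cong (λ c → freeIn S₁ E + ind (c ∧ E a)) (sym Sa) ⟩
  freeIn S₁ E + ind (lookup S a ∧ E a)  ≡⟨ freeIn-update S E a inside ⟩
  freeIn S E + ind (E a)                ≡⟨ cong (λ c → freeIn S E + ind c) Ea ⟩
  freeIn S E + 1                        ∎)
  where
  open ≡-Reasoning
  S₁ S₂ : Subset _
  S₁ = S [ a ]≔ inside
  S₂ = exchange S a b
  S₁b : lookup S₁ b ≡ true
  S₁b = trans (lookup∘update′ (≢-sym (distinct-by (lookup S) Sb Sa)) S inside) Sb

record Reshuffle {n k} (E : Fin n → Bool) (𝒮 𝒮′ : SetSystem n k) : Set where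
  field
    frozen    : ∀ l z → E z ≡ false → mem 𝒮′ l z ≡ mem 𝒮 l z
    same-free : ∀ l → free 𝒮′ E l ≡ free 𝒮 E l

reshuffle-trans : ∀ {n k} {E : Fin n → Bool} {𝒮 𝒮₁ 𝒮₂ : SetSystem n k} →
  Reshuffle E 𝒮 𝒮₁ → Reshuffle E 𝒮₁ 𝒮₂ → Reshuffle E 𝒮 𝒮₂
reshuffle-trans first second = record
  { frozen    = λ l z Ez → trans (Reshuffle.frozen second l z Ez) (Reshuffle.frozen first l z Ez)
  ; same-free = λ l → trans (Reshuffle.same-free second l) (Reshuffle.same-free first l) }

exchange-reshuffle : ∀ {n k} {E : Fin n → Bool} (𝒮 : SetSystem n k) j {a b} →
  E a ≡ true → E b ≡ true → mem 𝒮 j a ≡ false → mem 𝒮 j b ≡ true →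
  Reshuffle E 𝒮 (𝒮 [ j ]≔ exchange (lookup 𝒮 j) a b)
exchange-reshuffle {E = E} 𝒮 j {a} {b} Ea Eb ja jb = record { frozen = frozen ; same-free = same-free }
  where
  𝒮′ : SetSystem _ _
  𝒮′ = 𝒮 [ j ]≔ exchange (lookup 𝒮 j) a b
  frozen : ∀ l z → E z ≡ false → mem 𝒮′ l z ≡ mem 𝒮 l z
  frozen l z Ez with l ≟ j
  ... | yes refl = trans (cong (λ S → lookup S z) (lookup∘update j 𝒮 _))
                         (exchange-rest (lookup 𝒮 j) (distinct-by E Ea Ez) (distinct-by E Eb Ez))
  ... | no l≢j   = cong (λ S → lookup S z) (lookup∘update′ l≢j 𝒮 _)
  same-free : ∀ l → free 𝒮′ E l ≡ free 𝒮 E l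
  same-free l with l ≟ j
  ... | yes refl = trans (cong (λ S → freeIn S E) (lookup∘update j 𝒮 _)) (freeIn-exchange (lookup 𝒮 j) E Ea Eb ja jb)
  ... | no l≢j   = cong (λ S → freeIn S E) (lookup∘update′ l≢j 𝒮 _)

record RoundOutcome {n k} (E : Fin n → Bool) (𝒮 𝒮′ : SetSystem n k) (i : Fin k) (x : Fin n) : Set where
  field
    reshuffle : Reshuffle E 𝒮 𝒮′
    placed    : mem 𝒮′ i x ≡ true
    disturbed : Fin k
    untouched : ∀ l → l ≢ i → l ≢ disturbed → lookup 𝒮′ l ≡ lookup 𝒮 l

round : ∀ {n k} {E : Fin n → Bool} {𝒮 𝒮′ : SetSystem n k} {i x y} →
  E x ≡ true → E y ≡ true → mem 𝒮 i x ≡ false → mem 𝒮 i y ≡ true →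
  Breaker₁Reply i x y (fixerMove 𝒮 i x y) 𝒮′ → RoundOutcome E 𝒮 𝒮′ i x
round {n} {k} {E} {𝒮} {i = i} {x} {y} Ex Ey ix iy = outcome
  where
  𝒮₁ : SetSystem n k
  𝒮₁ = fixerMove 𝒮 i x y
  fixer : Reshuffle E 𝒮 𝒮₁
  fixer = exchange-reshuffle 𝒮 i Ex Ey ix iy
  placed₁ : mem 𝒮₁ i x ≡ true
  placed₁ = trans (cong (λ S → lookup S x) (lookup∘update i 𝒮 _)) (exchange-in (lookup 𝒮 i) (distinct-by (mem 𝒮 i) iy ix))
  kept₁ : ∀ l → l ≢ i → lookup 𝒮₁ l ≡ lookup 𝒮 l
  kept₁ l l≢i = lookup∘update′ l≢i 𝒮 _
  -- Breaker's swap in a member j ≠ i is one more exchange of free elements.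
  swapped : ∀ j {a b} → j ≢ i → E a ≡ true → E b ≡ true → mem 𝒮₁ j a ≡ false → mem 𝒮₁ j b ≡ true →
    RoundOutcome E 𝒮 (𝒮₁ [ j ]≔ exchange (lookup 𝒮₁ j) a b) i x
  swapped j j≢i Ea Eb ja jb = record
    { reshuffle = reshuffle-trans fixer (exchange-reshuffle 𝒮₁ j Ea Eb ja jb)
    ; placed    = trans (cong (λ S → lookup S x) (lookup∘update′ (≢-sym j≢i) 𝒮₁ _)) placed₁
    ; disturbed = j
    ; untouched = λ l l≢i l≢j → trans (lookup∘update′ l≢j 𝒮₁ _) (kept₁ l l≢i) }
  outcome : ∀ {𝒮′} → Breaker₁Reply i x y 𝒮₁ 𝒮′ → RoundOutcome E 𝒮 𝒮′ i x
  outcome pass = record { reshuffle = fixer ; placed = placed₁ ; disturbed = i ; untouched = λ l l≢i _ → kept₁ l l≢i }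
  outcome (swapxy j j≢i x∈j y∉j) = swapped j j≢i Ey Ex (∉⇒false y∉j) ([]=⇒lookup x∈j)
  outcome (swapyx j j≢i y∈j x∉j) = swapped j j≢i Ex Ey (∉⇒false x∉j) ([]=⇒lookup y∈j)

-- The invariant of Fixer's strategy: E is the set of free elements and R the
-- set of open members.
record Good {n k} (𝒮 : SetSystem n k) (E : Fin n → Bool) (R : Fin k → Bool) : Set where
  field
    rep       : Fin k → Fin n
    rep-mem   : ∀ d → R d ≡ false → mem 𝒮 d (rep d) ≡ true
    rep-taken : ∀ d → R d ≡ false → E (rep d) ≡ false
    rep-inj   : ∀ d d′ → R d ≡ false → R d′ ≡ false → rep d ≡ rep d′ → d ≡ d′
    enough    : count R ≤ count E
    special   : Fin k
    free≥1    : ∀ l → R l ≡ true → 1 ≤ free 𝒮 E l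
    free≥2    : ∀ l → R l ≡ true → l ≢ special → 2 ≤ free 𝒮 E l

good-transversal : ∀ {n k} {𝒮 : SetSystem n k} {E R} → Good 𝒮 E R → count R ≡ 0 → Transversal 𝒮
good-transversal {R = R} G none =
  rep , (λ {d} {d′} same → rep-inj d d′ (closed d) (closed d′) same) , λ d → true⇒∈ (rep-mem d (closed d))
  where
  open Good G
  closed : ∀ d → R d ≡ false
  closed = count-zero R (≤-reflexive none)

good-reshuffle : ∀ {n k} {𝒮 𝒮′ : SetSystem n k} {E R} → Good 𝒮 E R → Reshuffle E 𝒮 𝒮′ → Good 𝒮′ E R
good-reshuffle G shuffle = record
  { rep = rep ; rep-mem = λ d Rd → trans (frozen d (rep d) (rep-taken d Rd)) (rep-mem d Rd)
  ; rep-taken = rep-taken ; rep-inj = rep-inj ; enough = enough ; special = special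
  ; free≥1 = λ l Rl → subst (1 ≤_) (sym (same-free l)) (free≥1 l Rl)
  ; free≥2 = λ l Rl l≢s → subst (2 ≤_) (sym (same-free l)) (free≥2 l Rl l≢s) }
  where
  open Good G
  open Reshuffle shuffle

record Lockable {n k} (𝒮 : SetSystem n k) (E : Fin n → Bool) (R : Fin k → Bool)
                (i : Fin k) (e : Fin n) (m : Fin k) : Set where
  field
    i-open : R i ≡ true
    e-free : E e ≡ true
    e∈i    : mem 𝒮 i e ≡ true
    keeps₁ : ∀ l → R l ≡ true → l ≢ i → 1 + ind (mem 𝒮 l e) ≤ free 𝒮 E l
    keeps₂ : ∀ l → R l ≡ true → l ≢ i → l ≢ m → 2 + ind (mem 𝒮 l e) ≤ free 𝒮 E l

free-⊖ : ∀ {n k} (𝒮 : SetSystem n k) {E : Fin n → Bool} {e} l → E e ≡ true →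
  free 𝒮 (E ⊖ e) l + ind (mem 𝒮 l e) ≡ free 𝒮 E l
free-⊖ 𝒮 {E} {e} l Ee = begin
  count (λ z → mem 𝒮 l z ∧ (E ⊖ e) z) + ind (mem 𝒮 l e)  ≡⟨ cong₂ _+_ (sum-cong-≗ pointwise) (cong ind (sym Fe)) ⟩
  count (F ⊖ e) + ind (F e)                            ≡⟨ count-⊖ F e ⟩
  count F                                              ∎
  where
  open ≡-Reasoning
  F : Fin _ → Bool
  F z = mem 𝒮 l z ∧ E z
  Fe : F e ≡ mem 𝒮 l e
  Fe = trans (cong (mem 𝒮 l e ∧_) Ee) (∧-identityʳ _)
  pointwise : ∀ z → ind (mem 𝒮 l z ∧ (E ⊖ e) z) ≡ ind ((F ⊖ e) z)
  pointwise z with z ≟ e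
  ... | yes refl = cong ind (trans (cong (mem 𝒮 l e ∧_) (⊖-self E e)) (trans (∧-zeroʳ _) (sym (⊖-self F e))))
  ... | no z≢e   = cong ind (trans (cong (mem 𝒮 l z ∧_) (⊖-other E z≢e)) (sym (⊖-other F z≢e)))

lock : ∀ {n k} {𝒮 : SetSystem n k} {E R i e m} → Good 𝒮 E R → Lockable 𝒮 E R i e m →
  Good 𝒮 (E ⊖ e) (R ⊖ i)
lock {n} {k} {𝒮} {E} {R} {i} {e} {m} G L = record
  { rep = rep′ ; rep-mem = rep-mem′ ; rep-taken = rep-taken′ ; rep-inj = rep-inj′
  ; enough = enough′ ; special = m ; free≥1 = free≥1′ ; free≥2 = free≥2′ }
  where
  open Good G
  open Lockable L
  rep′ : Fin k → Fin n
  rep′ = updateAt rep i (const e)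
  rep′-other : ∀ {d} → d ≢ i → rep′ d ≡ rep d
  rep′-other {d} d≢i = updateAt-minimal d i rep d≢i
  was-closed : ∀ {d} → d ≢ i → (R ⊖ i) d ≡ false → R d ≡ false
  was-closed d≢i closed = trans (sym (⊖-other R d≢i)) closed
  old≢e : ∀ {d} → R d ≡ false → rep d ≢ e
  old≢e Rd = distinct-by E e-free (rep-taken _ Rd)
  rep-mem′ : ∀ d → (R ⊖ i) d ≡ false → mem 𝒮 d (rep′ d) ≡ true
  rep-mem′ d closed with d ≟ i
  ... | yes refl = trans (cong (mem 𝒮 i) (updateAt-updates i rep)) e∈i
  ... | no d≢i   = trans (cong (mem 𝒮 d) (rep′-other d≢i)) (rep-mem d (was-closed d≢i closed))
  rep-taken′ : ∀ d → (R ⊖ i) d ≡ false → (E ⊖ e) (rep′ d) ≡ false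
  rep-taken′ d closed with d ≟ i
  ... | yes refl = trans (cong (E ⊖ e) (updateAt-updates i rep)) (⊖-self E e)
  ... | no d≢i   = trans (cong (E ⊖ e) (rep′-other d≢i)) (⊖-false E (rep-taken d (was-closed d≢i closed)))
  rep-inj′ : ∀ d d′ → (R ⊖ i) d ≡ false → (R ⊖ i) d′ ≡ false → rep′ d ≡ rep′ d′ → d ≡ d′
  rep-inj′ d d′ closed closed′ same with d ≟ i | d′ ≟ i
  ... | yes refl | yes refl = refl
  ... | yes refl | no d′≢i  = ⊥-elim (old≢e (was-closed d′≢i closed′)
                                (trans (sym (rep′-other d′≢i)) (trans (sym same) (updateAt-updates i rep))))
  ... | no d≢i   | yes refl = ⊥-elim (old≢e (was-closed d≢i closed)
                                (trans (sym (rep′-other d≢i)) (trans same (updateAt-updates i rep))))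
  ... | no d≢i   | no d′≢i  = rep-inj d d′ (was-closed d≢i closed) (was-closed d′≢i closed′)
                                (trans (sym (rep′-other d≢i)) (trans same (rep′-other d′≢i)))
  enough′ : count (R ⊖ i) ≤ count (E ⊖ e)
  enough′ = +-cancelʳ-≤ 1 _ _ (subst₂ _≤_ (sym (count-⊖-true R i-open)) (sym (count-⊖-true E e-free)) enough)
  after-lock : ∀ {l t} → t + ind (mem 𝒮 l e) ≤ free 𝒮 E l → t ≤ free 𝒮 (E ⊖ e) l
  after-lock {l} le = +-cancelʳ-≤ (ind (mem 𝒮 l e)) _ _ (≤-trans le (≤-reflexive (sym (free-⊖ 𝒮 l e-free))))
  free≥1′ : ∀ l → (R ⊖ i) l ≡ true → 1 ≤ free 𝒮 (E ⊖ e) l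
  free≥1′ l open′ with ⊖-true R open′
  ... | l≢i , Rl = after-lock (keeps₁ l Rl l≢i)
  free≥2′ : ∀ l → (R ⊖ i) l ≡ true → l ≢ m → 2 ≤ free 𝒮 (E ⊖ e) l
  free≥2′ l open′ l≢m with ⊖-true R open′
  ... | l≢i , Rl = after-lock (keeps₂ l Rl l≢i l≢m)

module Advance {n k} {𝒮 : SetSystem n k} {E : Fin n → Bool} {R : Fin k → Bool} {r : ℕ}
  (G : Good 𝒮 E R) (opens : count R ≡ suc r)
  (continue : ∀ {𝒮′ : SetSystem n k} {E′ : Fin n → Bool} {R′ : Fin k → Bool} →
              count R′ ≡ r → Good 𝒮′ E′ R′ → FixerWins₁ 𝒮′) where

  open Good G

  lock-and-continue : ∀ {𝒮′ i e m} → Good 𝒮′ E R → Lockable 𝒮′ E R i e m → FixerWins₁ 𝒮′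
  lock-and-continue G′ L = continue fewer (lock G′ L)
    where
    fewer : count (R ⊖ _) ≡ r
    fewer = +-cancelʳ-≡ 1 _ _ (trans (count-⊖-true R (Lockable.i-open L)) (trans opens (+-comm 1 r)))

  pivot : ∃ λ i → R i ≡ true × (∀ l → R l ≡ true → l ≢ i → 2 ≤ free 𝒮 E l)
  pivot with R special in Rs
  ... | true  = special , Rs , free≥2
  ... | false with count-witness R (subst (1 ≤_) (sym opens) (s≤s z≤n))
  ...   | i , Ri = i , Ri , λ l Rl _ → free≥2 l Rl (≢-sym (distinct-by R Rl Rs))

  -- Fixer trades a
  -- free element y of the pivot i for x; after Breaker's reply, i is locked
  -- with x and the member Breaker touched becomes special.
  play : ∀ {i} → R i ≡ true → (∀ l → R l ≡ true → l ≢ i → 2 ≤ free 𝒮 E l) →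
    ∀ {x} → E x ≡ true → (∀ l → R l ≡ true → mem 𝒮 l x ≡ false) → FixerWins₁ 𝒮
  play {i} Ri others≥2 {x} Ex unused with count-witness (λ z → mem 𝒮 i z ∧ E z) (free≥1 i Ri)
  ... | y , iy∧Ey = move i x y (false⇒∉ (unused i Ri)) (true⇒∈ iy) respond
    where
    iy : mem 𝒮 i y ≡ true
    iy = proj₁ (∧-true iy∧Ey)
    Ey : E y ≡ true
    Ey = proj₂ (∧-true {mem 𝒮 i y} iy∧Ey)
    respond : ∀ 𝒮′ → Breaker₁Reply i x y (fixerMove 𝒮 i x y) 𝒮′ → FixerWins₁ 𝒮′
    respond 𝒮′ reply = lock-and-continue (good-reshuffle G reshuffle) (record
      { i-open = Ri ; e-free = Ex ; e∈i = placed
      ; keeps₁ = λ l Rl l≢i → ≤-trans (+-monoʳ-≤ 1 (ind≤1 _)) (still≥2 l Rl l≢i)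
      ; keeps₂ = λ l Rl l≢i l≢j → subst (λ b → 2 + ind b ≤ free 𝒮′ E l) (sym (x-absent l Rl l≢i l≢j)) (still≥2 l Rl l≢i) })
      where
      open RoundOutcome (round {E = E} Ex Ey (unused i Ri) iy reply)
      still≥2 : ∀ l → R l ≡ true → l ≢ i → 2 ≤ free 𝒮′ E l
      still≥2 l Rl l≢i = subst (2 ≤_) (sym (Reshuffle.same-free reshuffle l)) (others≥2 l Rl l≢i)
      x-absent : ∀ l → R l ≡ true → l ≢ i → l ≢ disturbed → mem 𝒮′ l x ≡ false
      x-absent l Rl l≢i l≢j = trans (cong (λ S → lookup S x) (untouched l l≢i l≢j)) (unused l Rl)

  tight : Fin k → Bool
  tight l = R l ∧ (free 𝒮 E l ≤ᵇ 2)

  tight-bound : ∀ {l} → tight l ≡ true → free 𝒮 E l ≤ 2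
  tight-bound {l} tl = ≤ᵇ⇒≤ _ 2 (subst T (sym (proj₂ (∧-true {R l} tl))) _)

  slack : ∀ {l} → R l ≡ true → tight l ≡ false → 3 ≤ free 𝒮 E l
  slack Rl not-tight = ≰⇒> (λ ≤2 → subst T (trans (sym (cong (_∧ _) Rl)) not-tight) (≤⇒≤ᵇ ≤2))

  tight-at : Fin n → Fin k → Bool
  tight-at e l = tight l ∧ mem 𝒮 l e

  degree : Fin n → ℕ
  degree e = count (tight-at e)

  tight-weight : ∀ l → ind (tight l) * free 𝒮 E l ≤ 2 * ind (R l)
  tight-weight l with tight l in tl
  ... | false = z≤n
  ... | true  = subst (λ b → free 𝒮 E l + 0 ≤ 2 * ind b) (sym (proj₁ (∧-true {R l} tl)))
                  (≤-trans (≤-reflexive (+-identityʳ _)) (tight-bound tl))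

  -- Both sides count pairs (free element, tight member containing it).
  incidences : ∑[ z < n ] (ind (E z) * degree z) ≡ ∑[ l < k ] (ind (tight l) * free 𝒮 E l)
  incidences = double-count tight E (mem 𝒮)

  common-element : ∃ λ e → E e ≡ true × degree e ≤ 2
  common-element with pigeonhole E degree 3 (begin-strict
      ∑[ z < n ] (ind (E z) * degree z)          ≡⟨ incidences ⟩
      ∑[ l < k ] (ind (tight l) * free 𝒮 E l)   ≤⟨ sum-≤-scaled 2 R tight-weight ⟩
      2 * count R                             ≤⟨ *-monoʳ-≤ 2 enough ⟩
      2 * count E                             <⟨ +-monoˡ-≤ (2 * count E) E-nonempty ⟩
      3 * count E                             ∎)
    where
    open ≤-Reasoning
    E-nonempty : 1 ≤ count E
    E-nonempty = ≤-trans (subst (1 ≤_) (sym opens) (s≤s z≤n)) enough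
  ... | e , Ee , deg<3 = e , Ee , ≤-pred deg<3

  rare-element : ∀ l₀ → R l₀ ≡ true → free 𝒮 E l₀ ≤ 1 → ∃ λ e → E e ≡ true × degree e ≤ 1
  rare-element l₀ Rl₀ l₀≤1 with pigeonhole E degree 2 (begin-strict
      ∑[ z < n ] (ind (E z) * degree z)          ≡⟨ incidences ⟩
      ∑[ l < k ] (ind (tight l) * free 𝒮 E l)   <⟨ sum-<-scaled 2 R tight-weight l₀ below ⟩
      2 * count R                             ≤⟨ *-monoʳ-≤ 2 enough ⟩
      2 * count E                             ∎)
    where
    open ≤-Reasoning
    below : ind (tight l₀) * free 𝒮 E l₀ < 2 * ind (R l₀)
    below = subst (λ b → ind (tight l₀) * free 𝒮 E l₀ < 2 * ind b) (sym Rl₀)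
                  (s≤s (≤-trans (ind-*-≤ (tight l₀) _) l₀≤1))
  ... | e , Ee , deg<2 = e , Ee , ≤-pred deg<2

  slack-at : ∀ {e l} → R l ≡ true → mem 𝒮 l e ≡ true → tight-at e l ≡ false → 3 ≤ free 𝒮 E l
  slack-at Rl le not-tight-at = slack Rl (∧-false-if le not-tight-at)

  holder : ∀ {e d} → R d ≡ true → mem 𝒮 d e ≡ true →
    ∃ λ i → R i ≡ true × mem 𝒮 i e ≡ true × (∀ {t} → degree e ≤ suc t → count (tight-at e ⊖ i) ≤ t)
  holder {e} {d} Rd de with pick (tight-at e) d
  ... | i , inj₁ Ui , drop    = i , proj₁ (∧-true (proj₁ (∧-true Ui))) , proj₂ (∧-true Ui) , drop
  ... | .d , inj₂ refl , drop = d , Rd , de , drop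

  keeps : ∀ {l e t} → (mem 𝒮 l e ≡ true → suc t ≤ free 𝒮 E l) → t ≤ free 𝒮 E l →
    t + ind (mem 𝒮 l e) ≤ free 𝒮 E l
  keeps {l} {e} {t} if-in otherwise with mem 𝒮 l e
  ... | true  = subst (_≤ free 𝒮 E l) (+-comm 1 t) (if-in refl)
  ... | false = subst (_≤ free 𝒮 E l) (sym (+-identityʳ t)) otherwise

  -- Case B, some open member has at most one free element: lock a holder of
  -- a free element e in at most one tight member; the special member stays.
  lock-rare : ∀ {e d} → E e ≡ true → degree e ≤ 1 → R d ≡ true → mem 𝒮 d e ≡ true → FixerWins₁ 𝒮
  lock-rare {e} Ee deg≤1 Rd de with holder Rd de
  ... | i , Ri , ie , drop = lock-and-continue G (record
    { i-open = Ri ; e-free = Ee ; e∈i = ie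
    ; keeps₁ = λ l Rl l≢i → keeps (λ le → ≤-trans (n≤1+n 2) (big l Rl l≢i le)) (free≥1 l Rl)
    ; keeps₂ = λ l Rl l≢i l≢s → keeps (big l Rl l≢i) (free≥2 l Rl l≢s) })
    where
    big : ∀ l → R l ≡ true → l ≢ i → mem 𝒮 l e ≡ true → 3 ≤ free 𝒮 E l
    big l Rl l≢i le = slack-at Rl le (trans (sym (⊖-other (tight-at e) l≢i)) (count-zero (tight-at e ⊖ i) (drop deg≤1) l))

  -- Case B, every open member has two free elements: lock a holder of a free
  -- element e in at most two tight members; the other one becomes special.
  lock-common : (∀ l → R l ≡ true → 2 ≤ free 𝒮 E l) →
    ∀ {e d} → E e ≡ true → degree e ≤ 2 → R d ≡ true → mem 𝒮 d e ≡ true → FixerWins₁ 𝒮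
  lock-common all≥2 {e} Ee deg≤2 Rd de with holder Rd de
  ... | i , Ri , ie , drop with pick (tight-at e ⊖ i) i
  ...   | m , _ , drop₂ = lock-and-continue G (record
    { i-open = Ri ; e-free = Ee ; e∈i = ie
    ; keeps₁ = λ l Rl _ → keeps (λ _ → all≥2 l Rl) (≤-trans (n≤1+n 1) (all≥2 l Rl))
    ; keeps₂ = λ l Rl l≢i l≢m → keeps (big l Rl l≢i l≢m) (all≥2 l Rl) })
    where
    big : ∀ l → R l ≡ true → l ≢ i → l ≢ m → mem 𝒮 l e ≡ true → 3 ≤ free 𝒮 E l
    big l Rl l≢i l≢m le = slack-at Rl le
      (trans (sym (⊖-other (tight-at e) l≢i))
        (trans (sym (⊖-other (tight-at e ⊖ i) l≢m)) (count-zero ((tight-at e ⊖ i) ⊖ m) (drop₂ (drop deg≤2)) l)))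

  use : ∀ {e} → E e ≡ true → (∀ {d} → R d ≡ true → mem 𝒮 d e ≡ true → FixerWins₁ 𝒮) → FixerWins₁ 𝒮
  use {e} Ee lock-with with any? (λ d → (R d ≟ᵇ true) ×-dec (mem 𝒮 d e ≟ᵇ true))
  ... | yes (d , Rd , de) = lock-with Rd de
  ... | no none with pivot
  ...   | i , Ri , others≥2 = play Ri others≥2 Ee (λ l Rl → ¬-not (λ le → none (l , Rl , le)))

  advance : FixerWins₁ 𝒮
  advance with any? (λ l → (R l ≟ᵇ true) ×-dec (free 𝒮 E l ≤? 1))
  ... | yes (l₀ , Rl₀ , l₀≤1) with rare-element l₀ Rl₀ l₀≤1
  ...   | e , Ee , deg≤1 = use Ee (lock-rare Ee deg≤1)
  advance | no none with common-element
  ...   | e , Ee , deg≤2 = use Ee (lock-common (λ l Rl → ≰⇒> (λ l≤1 → none (l , Rl , l≤1))) Ee deg≤2)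

good-wins : ∀ r {n k} {𝒮 : SetSystem n k} {E R} → count R ≡ r → Good 𝒮 E R → FixerWins₁ 𝒮
good-wins zero    opens G = done (good-transversal G opens)
good-wins (suc r) opens G = Advance.advance G opens (good-wins r)

-- At the start every element is free and every member is open.
full : ∀ {n} → Fin n → Bool
full _ = true

count-full : ∀ n → count (full {n}) ≡ n
count-full zero    = refl
count-full (suc n) = cong suc (count-full n)

freeIn-full : ∀ {n} (S : Subset n) → freeIn S full ≡ ∣ S ∣
freeIn-full []          = refl
freeIn-full (true ∷ S)  = cong suc (freeIn-full S)
freeIn-full (false ∷ S) = freeIn-full S

initial : ∀ {n k} (𝒮 : SetSystem n k) (s : Fin k) →
  (∀ l → 1 ≤ ∣ lookup 𝒮 l ∣) → (∀ l → l ≢ s → 2 ≤ ∣ lookup 𝒮 l ∣) → k ≤ n → Good 𝒮 full full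
initial {n} {k} 𝒮 s sizes≥1 sizes≥2 k≤n = record
  { rep = λ d → inject≤ d k≤n ; rep-mem = λ _ () ; rep-taken = λ _ () ; rep-inj = λ _ _ ()
  ; enough = subst₂ _≤_ (sym (count-full k)) (sym (count-full n)) k≤n ; special = s
  ; free≥1 = λ l _ → subst (1 ≤_) (sym (freeIn-full (lookup 𝒮 l))) (sizes≥1 l)
  ; free≥2 = λ l _ l≢s → subst (2 ≤_) (sym (freeIn-full (lookup 𝒮 l))) (sizes≥2 l l≢s) }

corollary3p1 : (n m : ℕ) (𝒮 : SetSystem n (suc m)) →
    1 ≤ ∣ lookup 𝒮 (fromℕ m) ∣ →
    (∀ (i : Fin m) → 2 ≤ ∣ lookup 𝒮 (inject₁ i) ∣) →
    suc m ≤ n →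
    FixerWins₁ 𝒮
corollary3p1 n m 𝒮 last≥1 others≥2 members≤elements =
  good-wins (suc m) (count-full (suc m)) (initial 𝒮 (fromℕ m) sizes≥1 sizes≥2 members≤elements)
  where
  sizes≥2 : ∀ l → l ≢ fromℕ m → 2 ≤ ∣ lookup 𝒮 l ∣
  sizes≥2 l l≢last = subst (λ j → 2 ≤ ∣ lookup 𝒮 j ∣) (inject₁-lower₁ l m≢l) (others≥2 (lower₁ l m≢l))
    where
    m≢l : m ≢ toℕ l
    m≢l m≡l = l≢last (toℕ-injective (trans (sym m≡l) (sym (toℕ-fromℕ m))))
  sizes≥1 : ∀ l → 1 ≤ ∣ lookup 𝒮 l ∣
  sizes≥1 l with l ≟ fromℕ m
  ... | yes refl    = last≥1
  ... | no l≢last   = ≤-trans (n≤1+n 1) (sizes≥2 l l≢last)
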